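{- Let $\rho: d\to k^{\mathsf{u}}$ be a function. Then $P(\rho)\neq\emptyset$ if and only if $\rho$ is non-decreasing.
   Context: Fix a finite relational language $\mathcal{L}=\{U_i:i<k^{\mathsf{u}}\}\cup\{R_i:i<k\}$ ($U_i$ unary, $R_i$ binary). All $\mathcal{L}$-structures satisfy: each vertex satisfies exactly one $U_i$ (write $U(a)=i$); $R_i(a,a)$ never holds; distinct $a,b$ satisfy exactly one $R_i(a,b)$ (write $R(a,b)=i$); there is an involution $\mathrm{Flip}$ of $k$ fixing $0$ with $R_i(a,b)\iff R_{\mathrm{Flip}(i)}(b,a)$; $R=0$ means "no relation". Irreducible: $R(a,b)\ne0$ for all distinct $a,b$. $\mathcal{F}$ is a finite set of finite irreducible $\mathcal{L}$-structures, $\mathcal{K}=\mathrm{Forb}(\mathcal{F})$ (finite structures omitting all members of $\mathcal{F}$). Standing assumption: every $i<k^{\mathsf{u}}$ is non-degenerate, i.e. some two-element structure in $\mathcal{K}$ has a vertex with unary $i$ and its two vertices related by a nonzero relation. Enumerated structures have underlying set a cardinal; $\mathbf{K}_n$ is the induced substructure on $\{0,\dots,n-1\}$. $\mathbf{K}$ is a fixed enumerated Fra\"iss\'e limit of $\mathcal{K}$ that is left dense (for every enumerated $\mathbf{B}\in\mathcal{K}$ with $|\mathbf{B}|=m+1$, $\mathbf{B}_m=\mathbf{K}_m$, there is an order-preserving embedding $f:\mathbf{B}\to\mathbf{K}$ fixing $\{0,\dots,m-1\}$ with $R(f(m),r)=0$ for $m\le r<f(m)$). Trees: $T=k^{\mathsf{u}}\times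 k^{<\omega}$, $t=(t^{\mathsf{u}},t^{\mathsf{b}})$, $\ell(t)=|t^{\mathsf{b}}|$, $T(n)=\{t:\ell(t)=n\}$; $s\sqsubseteq t$ iff $s^{\mathsf{u}}=t^{\mathsf{u}}$ and $t^{\mathsf{b}}$ extends $s^{\mathsf{b}}$; $\preceq_{lex}$ on $T(n)$ compares unaries first, then $t^{\mathsf{b}}$ lexicographically. The coding map $c:\mathbf{K}\to T$ has $c(n)\in T(n)$, $c(n)^{\mathsf{u}}=U(n)$, $c(n)^{\mathsf{b}}(m)=R(n,m)$ for $m<n$; $\mathrm{CT}=\{t\in T: t\sqsubseteq c(a)\text{ for some }a\}$, $\mathrm{CT}(n)=\mathrm{CT}\cap T(n)$. An $\mathcal{L}_d$-structure has the binary symbols $R_i$ (same conventions) and unary symbols $V_0,\dots,V_{d-1}$ with each vertex in exactly one $V_j$ (write $V(b)=j$); its underlying set is disjoint from $\omega$. For $S=\{s_0\prec_{lex}\dots\prec_{lex}s_{d-1}\}\subseteq T(n)$ and an $\mathcal{L}_d$-structure $\mathbf{B}$, $\mathbf{B}[S]$ is the $\mathcal{L}$-structure on $\{0,\dots,n-1\}\cup B$ which is $\mathbf{K}_n$ on $\{0,\dots,n-1\}$, has the binary part of $\mathbf{B}$ on $B$, $U(b)=s_{V(b)}^{\mathsf{u}}$, and $R(b,x)=s_{V(b)}^{\mathsf{b}}(x)$ for $b\in B$, $x<n$. $\mathcal{K}(S)=\{\mathbf{B}\text{ finite }\mathcal{L}_d\text{ -structure}:\mathbf{B}[S]\in\mathcal{K}\}$,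 and $S^{\mathsf{u}}:d\to k^{\mathsf{u}}$, $S^{\mathsf{u}}(j)=s_j^{\mathsf{u}}$. For $\rho:d\to k^{\mathsf{u}}$, $P(\rho)=\{\mathcal{K}(S): n<\omega,\ S\subseteq\mathrm{CT}(n),\ S^{\mathsf{u}}=\rho\}$. -}

module Defs where

open import Data.Nat as ℕ using (ℕ; zero; suc)
open import Data.Fin as F using (Fin; toℕ; fromℕ; inject₁; inject≤)
open import Data.Vec using (Vec; []; _∷_; tabulate; lookup)
open import Data.Product using (Σ; ∃; _×_; _,_; proj₁; proj₂)
open import Data.Sum using (_⊎_; inj₁; inj₂)
open import Data.Empty using (⊥)
open import Data.List using (List)
open import Data.List.Relation.Unary.All using (All)
open import Relation.Binary.PropositionalEquality using (_≡_; _≢_; refl; sym)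
open import Relation.Nullary using (¬_)
open import Function using (_⇔_)
open import Function.Definitions using (Injective; Surjective)

-- The language: k^u unary symbols, k = suc k' binary symbols R_0..R_{k-1},
-- and an involution Flip of k fixing 0.

record Lang : Set where
  field
    ku k' : ℕ
    Flip : Fin (suc k') → Fin (suc k')
    Flip-invol : ∀ i → Flip (Flip i) ≡ i
    Flip-0 : Flip F.zero ≡ F.zero

module _ (L : Lang) where
  open Lang L

  k : ℕ
  k = suc k'

  -- A structure with u unary symbols (each vertex in exactly one: U)
  -- and the binary symbols R_i (each ordered pair gets exactly one R: R),
  -- on carrier A.  u = ku gives L-structures, u = d gives L_d-structures.
  record Str (u : ℕ) (A : Set) : Set where
    field
      U : A → Fin u
      R : A → A → Fin k
      R-irrefl : ∀ a → R a a ≡ F.zero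
      R-flip : ∀ a b → R b a ≡ Flip (R a b)

  open Str public

  FinStr : Set
  FinStr = Σ ℕ λ m → Str ku (Fin m)

  IsEmbedding : ∀ {u A B} → Str u A → Str u B → (A → B) → Set
  IsEmbedding M N f =
    Injective _≡_ _≡_ f
    × (∀ a → U N (f a) ≡ U M a)
    × (∀ a b → R N (f a) (f b) ≡ R M a b)

  Embeds : ∀ {u A B} → Str u A → Str u B → Set
  Embeds {A = A} {B} M N = Σ (A → B) (IsEmbedding M N)

  Irreducible : ∀ {u A} → Str u A → Set
  Irreducible {A = A} M = ∀ (a b : A) → a ≢ b → R M a b ≢ F.zero

  AllIrreducible : List FinStr → Set
  AllIrreducible ℱ = All (λ X → Irreducible (proj₂ X)) ℱ

  -- Level n of the tree T = k^u × k^{<ω}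
  Node : ℕ → Set
  Node n = Fin ku × Vec (Fin k) n

  _⊑_ : ∀ {n m} → Node n → Node m → Set
  _⊑_ {n} {m} s t =
    (proj₁ s ≡ proj₁ t) × Σ (n ℕ.≤ m) λ p →
      ∀ (i : Fin n) → lookup (proj₂ s) i ≡ lookup (proj₂ t) (inject≤ i p)

  data LexV : ∀ {n} → Vec (Fin k) n → Vec (Fin k) n → Set where
    here : ∀ {n a b} {as bs : Vec (Fin k) n} → a F.< b → LexV (a ∷ as) (b ∷ bs)
    there : ∀ {n a} {as bs : Vec (Fin k) n} → LexV as bs → LexV (a ∷ as) (a ∷ bs)

  _≺lex_ : ∀ {n} → Node n → Node n → Set
  s ≺lex t = (proj₁ s F.< proj₁ t) ⊎ ((proj₁ s ≡ proj₁ t) × LexV (proj₂ s) (proj₂ t))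

  NonDecreasing : ∀ {d} → (Fin d → Fin ku) → Set
  NonDecreasing {d} ρ = ∀ (i j : Fin d) → i F.≤ j → ρ i F.≤ ρ j

module _ (L : Lang) (ℱ : List (FinStr L)) where
  open Lang L

  InK : ∀ {A} → Str L ku A → Set
  InK M = All (λ X → ¬ Embeds L (proj₂ X) M) ℱ

  NonDegenerate : Set
  NonDegenerate = ∀ (i : Fin ku) → Σ (Str L ku (Fin 2)) λ A →
    InK A × (Σ (Fin 2) λ x → U A x ≡ i) × (R A F.zero (F.suc F.zero) ≢ F.zero)

  -- K (on ω) is a Fraïssé limit of 𝒦: its age is exactly 𝒦 and it is
  -- ultrahomogeneous (every isomorphism between finite substructures,
  -- given by two enumerations f, g inducing the same structure,
  -- extends to an automorphism).
  FraisseLimit : Str L ku ℕ → Set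
  FraisseLimit K =
    (∀ (m : ℕ) (A : Str L ku (Fin m)) → (Embeds L A K ⇔ InK A))
    × (∀ (m : ℕ) (f g : Fin m → ℕ) → Injective _≡_ _≡_ f → Injective _≡_ _≡_ g
        → (∀ i → U K (f i) ≡ U K (g i))
        → (∀ i j → R K (f i) (f j) ≡ R K (g i) (g j))
        → Σ (ℕ → ℕ) λ σ → IsEmbedding L K K σ × Surjective _≡_ _≡_ σ
            × (∀ i → σ (f i) ≡ g i))

  LeftDense : Str L ku ℕ → Set
  LeftDense K = ∀ (m : ℕ) (B : Str L ku (Fin (suc m))) → InK B
    → (∀ (i : Fin m) → U B (inject₁ i) ≡ U K (toℕ i))
    → (∀ (i j : Fin m) → R B (inject₁ i) (inject₁ j) ≡ R K (toℕ i) (toℕ j))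
    → Σ (Fin (suc m) → ℕ) λ f → IsEmbedding L B K f
        × (∀ i j → i F.< j → f i ℕ.< f j)
        × (∀ (i : Fin m) → f (inject₁ i) ≡ toℕ i)
        × (∀ (r : ℕ) → m ℕ.≤ r → r ℕ.< f (fromℕ m) → R K (f (fromℕ m)) r ≡ F.zero)

module _ (L : Lang) (ℱ : List (FinStr L)) (K : Str L (Lang.ku L) ℕ) where
  open Lang L

  c : (a : ℕ) → Node L a
  c a = U K a , tabulate (λ m → R K a (toℕ m))

  CT : (n : ℕ) → Node L n → Set
  CT n t = Σ ℕ λ a → _⊑_ L t (c a)

  -- S = {s_0 ≺lex … ≺lex s_{d-1}} ⊆ T(n), given by its increasing enumeration
  IncreasingEnum : ∀ {d n} → (Fin d → Node L n) → Set
  IncreasingEnum {d} s = ∀ (i j : Fin d) → i F.< j → _≺lex_ L (s i) (s j)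

  FinLdStr : ℕ → Set
  FinLdStr d = Σ ℕ λ m → Str L d (Fin m)

  plug : ∀ {d n m} → (Fin d → Node L n) → Str L d (Fin m) → Str L ku (Fin n ⊎ Fin m)
  plug {d} {n} {m} s B = record
    { U = Uf ; R = Rf ; R-irrefl = irr ; R-flip = fl }
    where
      Uf : Fin n ⊎ Fin m → Fin ku
      Uf (inj₁ x) = U K (toℕ x)
      Uf (inj₂ b) = proj₁ (s (U B b))
      Rf : Fin n ⊎ Fin m → Fin n ⊎ Fin m → Fin (k L)
      Rf (inj₁ x) (inj₁ y) = R K (toℕ x) (toℕ y)
      Rf (inj₂ b) (inj₂ b') = R B b b'
      Rf (inj₂ b) (inj₁ x) = lookup (proj₂ (s (U B b))) x
      Rf (inj₁ x) (inj₂ b) = Flip (lookup (proj₂ (s (U B b))) x)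
      irr : ∀ a → Rf a a ≡ F.zero
      irr (inj₁ x) = R-irrefl K (toℕ x)
      irr (inj₂ b) = R-irrefl B b
      fl : ∀ a b → Rf b a ≡ Flip (Rf a b)
      fl (inj₁ x) (inj₁ y) = R-flip K (toℕ x) (toℕ y)
      fl (inj₂ b) (inj₂ b') = R-flip B b b'
      fl (inj₁ x) (inj₂ b) = sym (Flip-invol _)
      fl (inj₂ b) (inj₁ x) = refl

  KS : ∀ {d n} → (Fin d → Node L n) → FinLdStr d → Set
  KS s (m , B) = InK L ℱ (plug s B)

  P : ∀ {d} → (Fin d → Fin ku) → (FinLdStr d → Set) → Set
  P {d} ρ X = Σ ℕ λ n → Σ (Fin d → Node L n) λ s →
    IncreasingEnum s × (∀ j → CT n (s j)) × (∀ j → proj₁ (s j) ≡ ρ j)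
    × (∀ B → X B ⇔ KS s B)

-- A row over K_n with at most one nonzero entry, at a vertex whose unary
-- matches the far end of an edge of some two-vertex structure of 𝒦 starting
-- at the new unary, is realised in K: an irreducible substructure of the
-- one-point extension either avoids the new point (so lies in K) or lies in
-- its closed neighbourhood, which maps onto that edge.  By left density such
-- rows lie in CT.  For non-decreasing ρ choose, for each j,
-- a single nonzero entry at a position p j with p strictly decreasing; two
-- rows of equal unary then differ first at the smaller position, where only
-- the later one is nonzero, so the rows are ≺lex-increasing.  Conversely
-- ≺lex compares unaries first, so the unaries of any S are non-decreasing.
module Submission where

open import Defs
open import Data.Nat using (ℕ)
open import Data.Fin using (Fin)
open import Data.Product using (Σ)
open import Data.List using (List)
open import Function using (_⇔_)

open import Data.Nat as ℕ using (zero; suc; z≤n; s≤s)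
import Data.Nat.Properties as ℕₚ
open import Data.Fin as F using (toℕ; fromℕ; inject₁; inject≤)
import Data.Fin.Properties as Fₚ
open import Data.Vec using (tabulate; lookup)
open import Data.Vec.Properties using (lookup∘tabulate)
open import Data.Maybe as Maybe using (Maybe; just; nothing)
open import Data.Product using (∃; _×_; _,_; proj₁; proj₂)
open import Data.Sum using (inj₁; inj₂)
open import Data.Empty using (⊥-elim)
open import Data.Unit using (⊤; tt)
import Data.List.Relation.Unary.All as All
open import Relation.Binary.PropositionalEquality
open import Relation.Nullary using (¬_; Dec; yes; no)
open import Data.List.Membership.Propositional using (_∈_)
open import Function using (mk⇔; id; _∘_)
open import Function.Bundles using (Equivalence)
open import Function.Definitions using (Injective)

splitLast : ∀ {m} → Fin (suc m) → Maybe (Fin m)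
splitLast {zero} F.zero = nothing
splitLast {suc m} F.zero = just F.zero
splitLast {suc m} (F.suc i) = Maybe.map F.suc (splitLast i)

joinLast : ∀ {m} → Maybe (Fin m) → Fin (suc m)
joinLast nothing = fromℕ _
joinLast (just i) = inject₁ i

joinLast-map-suc : ∀ {m} (a : Maybe (Fin m)) → joinLast (Maybe.map F.suc a) ≡ F.suc (joinLast a)
joinLast-map-suc nothing = refl
joinLast-map-suc (just _) = refl

joinLast-splitLast : ∀ {m} (i : Fin (suc m)) → joinLast (splitLast i) ≡ i
joinLast-splitLast {zero} F.zero = refl
joinLast-splitLast {suc m} F.zero = refl
joinLast-splitLast {suc m} (F.suc i) =
  trans (joinLast-map-suc (splitLast i)) (cong F.suc (joinLast-splitLast i))

splitLast-injective : ∀ {m} → Injective _≡_ _≡_ (splitLast {m})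
splitLast-injective {x = i} {y = j} eq = begin
  i                      ≡⟨ sym (joinLast-splitLast i) ⟩
  joinLast (splitLast i) ≡⟨ cong joinLast eq ⟩
  joinLast (splitLast j) ≡⟨ joinLast-splitLast j ⟩
  j                      ∎
  where open ≡-Reasoning

splitLast-inject₁ : ∀ {m} (i : Fin m) → splitLast (inject₁ i) ≡ just i
splitLast-inject₁ {suc m} F.zero = refl
splitLast-inject₁ {suc m} (F.suc i) = cong (Maybe.map F.suc) (splitLast-inject₁ i)

splitLast-fromℕ : ∀ m → splitLast (fromℕ m) ≡ nothing
splitLast-fromℕ zero = refl
splitLast-fromℕ (suc m) = cong (Maybe.map F.suc) (splitLast-fromℕ m)

≟nothing : ∀ {A : Set} (a : Maybe A) → Dec (a ≡ nothing)
≟nothing nothing = yes refl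
≟nothing (just _) = no λ ()

fromJust : ∀ {A : Set} (a : Maybe A) → a ≢ nothing → ∃ λ b → a ≡ just b
fromJust nothing a≢nothing = ⊥-elim (a≢nothing refl)
fromJust (just b) _ = b , refl

last-≥ : ∀ m (f : Fin (suc m) → ℕ) → (∀ i j → i F.< j → f i ℕ.< f j)
       → (∀ i → f (inject₁ i) ≡ toℕ i) → m ℕ.≤ f (fromℕ m)
last-≥ zero f _ _ = z≤n
last-≥ (suc m) f f-mono f-fix = begin-strict
  m                        ≡⟨ sym (Fₚ.toℕ-fromℕ m) ⟩
  toℕ (fromℕ m)            ≡⟨ sym (f-fix (fromℕ m)) ⟩
  f (inject₁ (fromℕ m))    <⟨ f-mono _ _ (s≤s (ℕₚ.≤-reflexive (Fₚ.toℕ-inject₁ (fromℕ m)))) ⟩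
  f (fromℕ (suc m))        ∎
  where open ℕₚ.≤-Reasoning

single : ∀ {k n} → ℕ → Fin (suc k) → Fin n → Fin (suc k)
single p v r with toℕ r ℕ.≟ p
... | yes _ = v
... | no _ = F.zero

single-≢0 : ∀ {k n} p (v : Fin (suc k)) (r : Fin n) → single p v r ≢ F.zero → toℕ r ≡ p
single-≢0 p v r with toℕ r ℕ.≟ p
... | yes r≡p = λ _ → r≡p
... | no _ = λ 0≢0 → ⊥-elim (0≢0 refl)

single-at : ∀ {k n} p (v : Fin (suc k)) (r : Fin n) → toℕ r ≡ p → single p v r ≡ v
single-at p v r r≡p with toℕ r ℕ.≟ p
... | yes _ = refl
... | no r≢p = ⊥-elim (r≢p r≡p)

single-off : ∀ {k n} p (v : Fin (suc k)) (r : Fin n) → toℕ r ≢ p → single p v r ≡ F.zero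
single-off p v r r≢p with toℕ r ℕ.≟ p
... | yes r≡p = ⊥-elim (r≢p r≡p)
... | no _ = refl

module _ {L : Lang} where
  open Lang L

  tabulate-lex : ∀ {n} (f g : Fin n → Fin (k L)) (q : ℕ) → q ℕ.< n
    → (∀ r → toℕ r ℕ.< q → f r ≡ g r) → (∀ r → toℕ r ≡ q → f r F.< g r)
    → LexV L (tabulate f) (tabulate g)
  tabulate-lex {suc n} f g zero _ _ f<g = here (f<g F.zero refl)
  tabulate-lex {suc n} f g (suc q) (s≤s q<n) f≡g f<g
    rewrite f≡g F.zero (s≤s z≤n) =
    there (tabulate-lex (f ∘ F.suc) (g ∘ F.suc) q q<n
             (λ r r<q → f≡g (F.suc r) (s≤s r<q)) (λ r r≡q → f<g (F.suc r) (cong suc r≡q)))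

  single-lex : ∀ {n p q} (v w : Fin (k L)) → q ℕ.< p → q ℕ.< n → w ≢ F.zero
    → LexV L (tabulate (single {n = n} p v)) (tabulate (single q w))
  single-lex {p = p} {q} v w q<p q<n w≢0 = tabulate-lex _ _ q q<n zeros-before zero<w
    where
    zeros-before : ∀ r → toℕ r ℕ.< q → single p v r ≡ single q w r
    zeros-before r r<q = trans (single-off p v r (ℕₚ.<⇒≢ (ℕₚ.<-trans r<q q<p)))
                               (sym (single-off q w r (ℕₚ.<⇒≢ r<q)))
    zero<w : ∀ r → toℕ r ≡ q → single p v r F.< single q w r
    zero<w r r≡q rewrite single-off p v r (λ r≡p → ℕₚ.<⇒≢ q<p (trans (sym r≡q) r≡p))
                       | single-at q w r r≡q = Fₚ.≤∧≢⇒< z≤n (w≢0 ∘ sym)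

  nonDecreasing-unaries : ∀ {d n} (s : Fin d → Node L n) → (∀ i j → i F.< j → _≺lex_ L (s i) (s j))
    → NonDecreasing L (proj₁ ∘ s)
  nonDecreasing-unaries s s-inc i j i≤j with i Fₚ.≟ j
  ... | yes refl = Fₚ.≤-refl
  ... | no i≢j with s-inc i j (Fₚ.≤∧≢⇒< i≤j i≢j)
  ...   | inj₁ unary< = ℕₚ.<⇒≤ unary<
  ...   | inj₂ (unary≡ , _) = Fₚ.≤-reflexive unary≡

  Flip-≢0 : ∀ {i} → i ≢ F.zero → Flip i ≢ F.zero
  Flip-≢0 {i} i≢0 Flip-i≡0 = i≢0 (begin
    i               ≡⟨ sym (Flip-invol i) ⟩
    Flip (Flip i)   ≡⟨ cong Flip Flip-i≡0 ⟩
    Flip F.zero     ≡⟨ Flip-0 ⟩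
    F.zero          ∎)
    where open ≡-Reasoning

  pullback : ∀ {u A B} → Str L u B → (A → B) → Str L u A
  pullback N f = record
    { U = U N ∘ f
    ; R = λ a b → R N (f a) (f b)
    ; R-irrefl = R-irrefl N ∘ f
    ; R-flip = λ a b → R-flip N (f a) (f b)
    }

  embeds-via-pullback : ∀ {u A B C} {X : Str L u C} {N : Str L u B} {f : A → B}
    → Injective _≡_ _≡_ f → Embeds L X (pullback N f) → Embeds L X N
  embeds-via-pullback {f = f} f-inj (g , g-inj , g-U , g-R) = f ∘ g , (λ eq → g-inj (f-inj eq)) , g-U , g-R

  initial : ∀ {u} → Str L u ℕ → ∀ n → Str L u (Fin n)
  initial K n = pullback K toℕ

  extend : ∀ {u A} → Str L u A → Fin u → (A → Fin (k L)) → Str L u (Maybe A)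
  extend {u} {A} N v t = record { U = Uₑ ; R = Rₑ ; R-irrefl = irrefl ; R-flip = flip }
    where
    Uₑ : Maybe A → Fin u
    Uₑ nothing = v
    Uₑ (just a) = U N a
    Rₑ : Maybe A → Maybe A → Fin (k L)
    Rₑ nothing nothing = F.zero
    Rₑ nothing (just b) = t b
    Rₑ (just a) nothing = Flip (t a)
    Rₑ (just a) (just b) = R N a b
    irrefl : ∀ a → Rₑ a a ≡ F.zero
    irrefl nothing = refl
    irrefl (just a) = R-irrefl N a
    flip : ∀ a b → Rₑ b a ≡ Flip (Rₑ a b)
    flip nothing nothing = sym Flip-0
    flip nothing (just b) = refl
    flip (just a) nothing = sym (Flip-invol (t a))
    flip (just a) (just b) = R-flip N a b

  InApexNbhd : ∀ {A : Set} → (A → Fin (k L)) → Maybe A → Set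
  InApexNbhd t nothing = ⊤
  InApexNbhd t (just a) = t a ≢ F.zero

  module _ {u A C} {N : Str L u A} {v : Fin u} {t : A → Fin (k L)} {X : Str L u C}
           {g : C → Maybe A} (g-emb : IsEmbedding L X (extend N v t) g) where
    private
      g-inj = proj₁ g-emb
      g-U = proj₁ (proj₂ g-emb)
      g-R = proj₂ (proj₂ g-emb)

    embeds-avoiding-apex : (∀ c → g c ≢ nothing) → Embeds L X N
    embeds-avoiding-apex avoids = h , h-inj , h-U , h-R
      where
      h : C → A
      h c = proj₁ (fromJust (g c) (avoids c))
      g≡just∘h : ∀ c → g c ≡ just (h c)
      g≡just∘h c = proj₂ (fromJust (g c) (avoids c))
      h-inj : Injective _≡_ _≡_ h
      h-inj {c} {c′} eq = g-inj (trans (g≡just∘h c) (trans (cong just eq) (sym (g≡just∘h c′))))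
      h-U : ∀ c → U N (h c) ≡ U X c
      h-U c = trans (cong (U (extend N v t)) (sym (g≡just∘h c))) (g-U c)
      h-R : ∀ c c′ → R N (h c) (h c′) ≡ R X c c′
      h-R c c′ = trans (cong₂ (R (extend N v t)) (sym (g≡just∘h c)) (sym (g≡just∘h c′))) (g-R c c′)

    image-in-apex-nbhd : Irreducible L X → ∀ {c₀} → g c₀ ≡ nothing → ∀ c → InApexNbhd t (g c)
    image-in-apex-nbhd X-irr {c₀} gc₀≡nothing c with g c in gc
    ... | nothing = tt
    ... | just a = λ ta≡0 → X-irr c₀ c c₀≢c (begin
      R X c₀ c                        ≡⟨ sym (g-R c₀ c) ⟩
      R (extend N v t) (g c₀) (g c)   ≡⟨ cong₂ (R (extend N v t)) gc₀≡nothing gc ⟩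
      t a                             ≡⟨ ta≡0 ⟩
      F.zero                          ∎)
      where
      open ≡-Reasoning
      c₀≢c : c₀ ≢ c
      c₀≢c refl with trans (sym gc₀≡nothing) gc
      ... | ()

    -- Send the apex to x and each of its (at most one) neighbours to y.
    embeds-apex-nbhd-into-edge : ∀ {D} (B : Str L u D) {x y : D} → x ≢ y → U B x ≡ v
      → (∀ a → t a ≢ F.zero → U N a ≡ U B y × t a ≡ R B x y)
      → (∀ {a a′} → t a ≢ F.zero → t a′ ≢ F.zero → a ≡ a′)
      → (∀ c → InApexNbhd t (g c)) → Embeds L X B
    embeds-apex-nbhd-into-edge {D} B {x} {y} x≢y U-x matches unique near = ψ ∘ g , ψg-inj , ψg-U , ψg-R
      where
      ψ : Maybe A → D
      ψ nothing = x
      ψ (just _) = y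
      ψ-inj : ∀ a b → InApexNbhd t a → InApexNbhd t b → ψ a ≡ ψ b → a ≡ b
      ψ-inj nothing nothing _ _ _ = refl
      ψ-inj nothing (just _) _ _ x≡y = ⊥-elim (x≢y x≡y)
      ψ-inj (just _) nothing _ _ y≡x = ⊥-elim (x≢y (sym y≡x))
      ψ-inj (just a) (just b) ta≢0 tb≢0 _ = cong just (unique ta≢0 tb≢0)
      ψ-U : ∀ a → InApexNbhd t a → U B (ψ a) ≡ U (extend N v t) a
      ψ-U nothing _ = U-x
      ψ-U (just a) ta≢0 = sym (proj₁ (matches a ta≢0))
      ψ-R : ∀ a b → InApexNbhd t a → InApexNbhd t b → R B (ψ a) (ψ b) ≡ R (extend N v t) a b
      ψ-R nothing nothing _ _ = R-irrefl B x
      ψ-R nothing (just b) _ tb≢0 = sym (proj₂ (matches b tb≢0))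
      ψ-R (just a) nothing ta≢0 _ = trans (R-flip B x y) (cong Flip (sym (proj₂ (matches a ta≢0))))
      ψ-R (just a) (just b) ta≢0 tb≢0 rewrite unique ta≢0 tb≢0 =
        trans (R-irrefl B y) (sym (R-irrefl N b))
      ψg-inj : Injective _≡_ _≡_ (ψ ∘ g)
      ψg-inj {c} {c′} eq = g-inj (ψ-inj (g c) (g c′) (near c) (near c′) eq)
      ψg-U : ∀ c → U B (ψ (g c)) ≡ U X c
      ψg-U c = trans (ψ-U (g c) (near c)) (g-U c)
      ψg-R : ∀ c c′ → R B (ψ (g c)) (ψ (g c′)) ≡ R X c c′
      ψg-R c c′ = trans (ψ-R (g c) (g c′) (near c) (near c′)) (g-R c c′)

module _ {L : Lang} (ℱ : List (FinStr L)) where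
  open Lang L

  InK-pullback : ∀ {A B} {N : Str L ku B} {f : A → B} → Injective _≡_ _≡_ f
    → InK L ℱ N → InK L ℱ (pullback N f)
  InK-pullback {N = N} {f} f-inj =
    All.map (λ {X} X↛N X↪pullback → X↛N (embeds-via-pullback {X = proj₂ X} {N} {f} f-inj X↪pullback))

  record Edge (v : Fin ku) : Set where
    field
      structure : Str L ku (Fin 2)
      structure∈K : InK L ℱ structure
      source target : Fin 2
      source≢target : source ≢ target
      U-source : U structure source ≡ v
      colour≢0 : R structure source target ≢ F.zero

    colour : Fin (k L)
    colour = R structure source target

    targetU : Fin ku
    targetU = U structure target

  nonDegenerate⇒edge : NonDegenerate L ℱ → ∀ v → Edge v
  nonDegenerate⇒edge nd v with nd v
  ... | B , B∈K , (F.zero , U-x) , R01≢0 =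
    record { structure = B ; structure∈K = B∈K ; source = F.zero ; target = F.suc F.zero
           ; source≢target = λ () ; U-source = U-x ; colour≢0 = R01≢0 }
  ... | B , B∈K , (F.suc F.zero , U-x) , R01≢0 =
    record { structure = B ; structure∈K = B∈K ; source = F.suc F.zero ; target = F.zero
           ; source≢target = λ () ; U-source = U-x
           ; colour≢0 = subst (_≢ F.zero) (sym (R-flip B F.zero (F.suc F.zero))) (Flip-≢0 {L = L} R01≢0) }

  extend-InK : AllIrreducible L ℱ → ∀ {A} {N : Str L ku A} {v t} (E : Edge v)
    → (∀ a → t a ≢ F.zero → U N a ≡ Edge.targetU E × t a ≡ Edge.colour E)
    → (∀ {a a′} → t a ≢ F.zero → t a′ ≢ F.zero → a ≡ a′)
    → InK L ℱ N → InK L ℱ (extend N v t)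
  extend-InK irr {N = N} {v} {t} E matches unique N∈K = All.tabulate excluded
    where
    open Edge E
    excluded : ∀ {X} → X ∈ ℱ → ¬ Embeds L (proj₂ X) (extend N v t)
    excluded {X} X∈ℱ (g , g-emb) with Fₚ.any? (λ c → ≟nothing (g c))
    ... | yes (_ , g-hits-apex) = All.lookup structure∈K X∈ℱ
          (embeds-apex-nbhd-into-edge {L = L} {N = N} {v} {t} {proj₂ X} g-emb structure source≢target U-source matches unique
             (image-in-apex-nbhd {L = L} {N = N} {v} {t} {proj₂ X} g-emb (All.lookup irr X∈ℱ) g-hits-apex))
    ... | no g-misses-apex = All.lookup N∈K X∈ℱ
          (embeds-avoiding-apex {L = L} {N = N} {v} {t} {proj₂ X} g-emb (λ c gc≡nothing → g-misses-apex (c , gc≡nothing)))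

module _ {L : Lang} {ℱ : List (FinStr L)} {K : Str L (Lang.ku L) ℕ} where
  open Lang L

  limit-InK : FraisseLimit L ℱ K → InK L ℱ K
  limit-InK (age , _) = All.tabulate λ {X} X∈ℱ X↪K →
    All.lookup (Equivalence.to (age (proj₁ X) (proj₂ X)) X↪K) X∈ℱ
      (id , id , (λ _ → refl) , (λ _ _ → refl))

  realise : LeftDense L ℱ K → ∀ {n v} {t : Fin n → Fin (k L)} → InK L ℱ (extend (initial K n) v t)
    → Σ ℕ λ a → n ℕ.≤ a × U K a ≡ v × (∀ i → R K a (toℕ i) ≡ t i)
  realise ld {n} {v} {t} ext∈K with ld n B (InK-pullback ℱ {N = ext} splitLast-injective ext∈K) U-old R-old
    where
    ext = extend (initial K n) v t
    B : Str L ku (Fin (suc n))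
    B = pullback ext splitLast
    U-old : ∀ i → U B (inject₁ i) ≡ U K (toℕ i)
    U-old i = cong (U ext) (splitLast-inject₁ i)
    R-old : ∀ i j → R B (inject₁ i) (inject₁ j) ≡ R K (toℕ i) (toℕ j)
    R-old i j = cong₂ (R ext) (splitLast-inject₁ i) (splitLast-inject₁ j)
  ... | f , (_ , f-U , f-R) , f-mono , f-fix , _ = f (fromℕ n) , last-≥ n f f-mono f-fix , U-new , R-new
    where
    ext = extend (initial K n) v t
    U-new : U K (f (fromℕ n)) ≡ v
    U-new = trans (f-U (fromℕ n)) (cong (U ext) (splitLast-fromℕ n))
    R-new : ∀ i → R K (f (fromℕ n)) (toℕ i) ≡ t i
    R-new i = begin
      R K (f (fromℕ n)) (toℕ i)                     ≡⟨ cong (R K (f (fromℕ n))) (sym (f-fix i)) ⟩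
      R K (f (fromℕ n)) (f (inject₁ i))             ≡⟨ f-R (fromℕ n) (inject₁ i) ⟩
      R ext (splitLast (fromℕ n)) (splitLast (inject₁ i))
        ≡⟨ cong₂ (R ext) (splitLast-fromℕ n) (splitLast-inject₁ i) ⟩
      t i                                           ∎
      where open ≡-Reasoning

  realised-row-CT : LeftDense L ℱ K → ∀ {n v} {t : Fin n → Fin (k L)}
    → InK L ℱ (extend (initial K n) v t) → CT L ℱ K n (v , tabulate t)
  realised-row-CT ld {t = t} ext∈K with realise ld ext∈K
  ... | a , n≤a , U-a , R-a = a , sym U-a , n≤a , λ i → begin
    lookup (tabulate t) i                            ≡⟨ lookup∘tabulate t i ⟩
    t i                                              ≡⟨ sym (R-a i) ⟩
    R K a (toℕ i)                                    ≡⟨ cong (R K a) (sym (Fₚ.toℕ-inject≤ i n≤a)) ⟩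
    R K a (toℕ (inject≤ i n≤a))                      ≡⟨ sym (lookup∘tabulate _ (inject≤ i n≤a)) ⟩
    lookup (proj₂ (c L ℱ K a)) (inject≤ i n≤a)       ∎
    where open ≡-Reasoning

  P⇒nonDecreasing : ∀ {d} {ρ : Fin d → Fin ku} {X} → P L ℱ K ρ X → NonDecreasing L ρ
  P⇒nonDecreasing (_ , s , s-increasing , _ , s-unary , _) i j i≤j =
    subst₂ F._≤_ (s-unary i) (s-unary j) (nonDecreasing-unaries s s-increasing i j i≤j)

module _ {L : Lang} {ℱ : List (FinStr L)} (irr : AllIrreducible L ℱ) (nd : NonDegenerate L ℱ)
         {K : Str L (Lang.ku L) ℕ} (fl : FraisseLimit L ℱ K) (ld : LeftDense L ℱ K) where
  open Lang L

  private
    edge : ∀ v → Edge ℱ v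
    edge = nonDegenerate⇒edge ℱ nd

  initial∈K : ∀ n → InK L ℱ (initial K n)
  initial∈K n = InK-pullback ℱ {N = K} {toℕ {n}} Fₚ.toℕ-injective (limit-InK {ℱ = ℱ} {K} fl)

  vertex-above : ∀ v m → Σ ℕ λ a → m ℕ.≤ a × U K a ≡ v
  vertex-above v m with realise {ℱ = ℱ} {K} ld {m} {v} {λ _ → F.zero}
                          (extend-InK ℱ irr (edge v) (λ _ 0≢0 → ⊥-elim (0≢0 refl))
                                                     (λ 0≢0 _ → ⊥-elim (0≢0 refl)) (initial∈K m))
  ... | a , m≤a , U-a , _ = a , m≤a , U-a

  record DecreasingPositions {d} (w : Fin d → Fin ku) : Set where
    field
      bound : ℕ
      pos : Fin d → ℕ
      pos<bound : ∀ i → pos i ℕ.< bound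
      pos-decreasing : ∀ i j → i F.< j → pos j ℕ.< pos i
      U-pos : ∀ i → U K (pos i) ≡ w i

  prepend : ∀ {d} {w : Fin (suc d) → Fin ku} (P : DecreasingPositions (w ∘ F.suc))
    → ∀ a → DecreasingPositions.bound P ℕ.≤ a → U K a ≡ w F.zero → DecreasingPositions w
  prepend P a bound≤a U-a = record
    { bound = suc a ; pos = pos′ ; pos<bound = pos′<bound ; pos-decreasing = pos′-decreasing ; U-pos = U-pos′ }
    where
    open DecreasingPositions P
    pos′ : Fin _ → ℕ
    pos′ F.zero = a
    pos′ (F.suc i) = pos i
    pos′<bound : ∀ i → pos′ i ℕ.< suc a
    pos′<bound F.zero = ℕₚ.n<1+n a
    pos′<bound (F.suc i) = ℕₚ.<-≤-trans (pos<bound i) (ℕₚ.m≤n⇒m≤1+n bound≤a)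
    pos′-decreasing : ∀ i j → i F.< j → pos′ j ℕ.< pos′ i
    pos′-decreasing F.zero (F.suc j) _ = ℕₚ.<-≤-trans (pos<bound j) bound≤a
    pos′-decreasing (F.suc i) (F.suc j) (s≤s i<j) = pos-decreasing i j i<j
    U-pos′ : ∀ i → U K (pos′ i) ≡ _
    U-pos′ F.zero = U-a
    U-pos′ (F.suc i) = U-pos i

  decreasingPositions : ∀ {d} (w : Fin d → Fin ku) → DecreasingPositions w
  decreasingPositions {zero} w =
    record { bound = 0 ; pos = λ () ; pos<bound = λ () ; pos-decreasing = λ () ; U-pos = λ () }
  decreasingPositions {suc d} w with decreasingPositions (w ∘ F.suc)
  ... | P with vertex-above (w F.zero) (DecreasingPositions.bound P)
  ... | a , bound≤a , U-a = prepend P a bound≤a U-a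

  module _ {d} (ρ : Fin d → Fin ku) where
    open DecreasingPositions (decreasingPositions (Edge.targetU ∘ edge ∘ ρ))

    row : Fin d → Fin bound → Fin (k L)
    row j = single (pos j) (Edge.colour (edge (ρ j)))

    S : Fin d → Node L bound
    S j = ρ j , tabulate (row j)

    S-CT : ∀ j → CT L ℱ K bound (S j)
    S-CT j = realised-row-CT {ℱ = ℱ} {K} ld (extend-InK ℱ irr (edge (ρ j)) matches unique (initial∈K bound))
      where
      matches : ∀ r → row j r ≢ F.zero
        → U K (toℕ r) ≡ Edge.targetU (edge (ρ j)) × row j r ≡ Edge.colour (edge (ρ j))
      matches r r≢0 = trans (cong (U K) (single-≢0 _ _ r r≢0)) (U-pos j) , single-at _ _ r (single-≢0 _ _ r r≢0)
      unique : ∀ {r r′} → row j r ≢ F.zero → row j r′ ≢ F.zero → r ≡ r′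
      unique {r} {r′} r≢0 r′≢0 = Fₚ.toℕ-injective (trans (single-≢0 _ _ r r≢0) (sym (single-≢0 _ _ r′ r′≢0)))

    S-increasing : NonDecreasing L ρ → IncreasingEnum L ℱ K S
    S-increasing ρ↑ i j i<j with ℕₚ.m≤n⇒m<n∨m≡n (ρ↑ i j (ℕₚ.<⇒≤ i<j))
    ... | inj₁ ρi<ρj = inj₁ ρi<ρj
    ... | inj₂ ρi≡ρj = inj₂ (Fₚ.toℕ-injective ρi≡ρj ,
      single-lex _ _ (pos-decreasing i j i<j) (pos<bound j) (Edge.colour≢0 (edge (ρ j))))

    KS∈P : NonDecreasing L ρ → P L ℱ K ρ (KS L ℱ K S)
    KS∈P ρ↑ = bound , S , S-increasing ρ↑ , S-CT , (λ _ → refl) , (λ _ → mk⇔ id id)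

proposition4p8 : (L : Lang) (ℱ : List (FinStr L)) → AllIrreducible L ℱ
    → NonDegenerate L ℱ
    → (K : Str L (Lang.ku L) ℕ) → FraisseLimit L ℱ K → LeftDense L ℱ K
    → (d : ℕ) (ρ : Fin d → Fin (Lang.ku L))
    → (Σ (FinLdStr L ℱ K d → Set) (P L ℱ K ρ) ⇔ NonDecreasing L ρ)
proposition4p8 L ℱ irr nd K fl ld d ρ =
  mk⇔ (λ (_ , X∈P) → P⇒nonDecreasing {ℱ = ℱ} {K} X∈P) (λ ρ↑ → _ , KS∈P irr nd fl ld ρ ρ↑)
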